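{- Let $k\geq1$ and let $G$ be a $k$-tree. Then there is a book embedding of $G$ together with a partition of $E(G)$ into $k+1$ classes (colours), each class forming a star-forest no two of whose edges cross, such that: if $G\cong K_{k+1}$ then at least one vertex is colourful, and if $G\not\cong K_{k+1}$ then every $k$-simplicial vertex of $G$ is colourful.
   Context: Graphs are finite and simple. A vertex is $k$-simplicial if its neighbourhood is a clique of size $k$. A $k$-tree: $K_{k+1}$ is a $k$-tree, and if $G$ has a $k$-simplicial vertex $v$ and $G-v$ is a $k$-tree then $G$ is a $k$-tree. A book embedding places the vertices injectively at points in convex position in the plane and draws edges as straight segments; two edges cross if they intersect at a point other than a common endpoint. A star is a tree of diameter at most 2; a star-forest is a graph whose components are stars. Given a partition of the edges into colour classes, a vertex is colourful if all edges incident to it receive distinct colours. -}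

module Defs where

open import Data.Nat using (ℕ; zero; suc; _<_)
open import Data.Fin using (Fin; punchIn)
open import Data.Fin.Subset using (Subset; ∣_∣)
open import Data.Bool using (Bool; true; false; T)
open import Data.Vec using (tabulate)
open import Data.Product using (Σ; ∃; _×_; _,_)
open import Data.Sum using (_⊎_)
open import Relation.Nullary using (¬_)
open import Relation.Binary.PropositionalEquality using (_≡_; _≢_)
open import Function.Bundles using (_↔_; Inverse)
open import Function.Definitions using (Injective)

record Graph (n : ℕ) : Set where
  field
    adj   : Fin n → Fin n → Bool
    sym   : ∀ u v → adj u v ≡ adj v u
    irref : ∀ v → adj v v ≡ false
open Graph public

Edge : ∀ {n} → Graph n → Fin n → Fin n → Set
Edge G u v = T (adj G u v)

K : (m : ℕ) → Graph m
K m = record { adj = λ u v → isNe u v ; sym = symNe ; irref = irrNe }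
  where
  isNe : ∀ {m} → Fin m → Fin m → Bool
  isNe Fin.zero Fin.zero = false
  isNe Fin.zero (Fin.suc _) = true
  isNe (Fin.suc _) Fin.zero = true
  isNe (Fin.suc u) (Fin.suc v) = isNe u v
  symNe : ∀ {m} (u v : Fin m) → isNe u v ≡ isNe v u
  symNe Fin.zero Fin.zero = _≡_.refl
  symNe Fin.zero (Fin.suc _) = _≡_.refl
  symNe (Fin.suc _) Fin.zero = _≡_.refl
  symNe (Fin.suc u) (Fin.suc v) = symNe u v
  irrNe : ∀ {m} (v : Fin m) → isNe v v ≡ false
  irrNe Fin.zero = _≡_.refl
  irrNe (Fin.suc v) = irrNe v

_≅_ : ∀ {n m} → Graph n → Graph m → Set
_≅_ {n} {m} G H = Σ (Fin n ↔ Fin m) λ f →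
  ∀ u v → adj G u v ≡ adj H (Inverse.to f u) (Inverse.to f v)

delete : ∀ {n} → Graph (suc n) → Fin (suc n) → Graph n
delete G v = record
  { adj = λ i j → adj G (punchIn v i) (punchIn v j)
  ; sym = λ i j → sym G (punchIn v i) (punchIn v j)
  ; irref = λ i → irref G (punchIn v i) }

N : ∀ {n} → Graph n → Fin n → Subset n
N G v = tabulate (adj G v)

Simplicial : ℕ → ∀ {n} → Graph n → Fin n → Set
Simplicial k G v =
  (∣ N G v ∣ ≡ k) × (∀ x y → Edge G v x → Edge G v y → x ≢ y → Edge G x y)

data KTree (k : ℕ) : ∀ {n} → Graph n → Set where
  base : ∀ {n} (G : Graph n) → G ≅ K (suc k) → KTree k G
  step : ∀ {n} (G : Graph (suc n)) (v : Fin (suc n)) →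
         Simplicial k G v → KTree k (delete G v) → KTree k G

-- Book embedding: the vertices are placed at distinct points in convex
-- position; only their cyclic order matters, recorded by an injective
-- position map into ℕ (points ordered along the convex curve).
BookEmbedding : ℕ → Set
BookEmbedding n = Σ (Fin n → ℕ) Injective′
  where Injective′ : (Fin n → ℕ) → Set
        Injective′ p = Injective _≡_ _≡_ p

Between : ℕ → ℕ → ℕ → Set
Between a x b = (a < x × x < b) ⊎ (b < x × x < a)

-- straight-line chords ab and cd (points in convex position) cross iff
-- they have four distinct endpoints that interleave in the cyclic order
Cross : ∀ {n} → BookEmbedding n → Fin n → Fin n → Fin n → Fin n → Set
Cross (p , _) a b c d =
  (a ≢ c) × (a ≢ d) × (b ≢ c) × (b ≢ d) ×
  ((Between (p a) (p c) (p b) × ¬ Between (p a) (p d) (p b)) ⊎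
   (Between (p a) (p d) (p b) × ¬ Between (p a) (p c) (p b)))

data Reach {n} (E : Fin n → Fin n → Set) : Fin n → Fin n → Set where
  here : ∀ {u} → Reach E u u
  there : ∀ {u v w} → E u v → Reach E v w → Reach E u w

-- a star-forest: every component is a star, i.e. every component that
-- contains an edge has a centre c incident with all edges of the component
StarForest : ∀ {n} → (Fin n → Fin n → Set) → Set
StarForest {n} E = ∀ u v → E u v → ∃ λ (c : Fin n) → (c ≡ u ⊎ c ≡ v) ×
  (∀ x y → E x y → Reach E u x → (c ≡ x ⊎ c ≡ y))

-- edge colourings with m colours: a colour for each ordered pair,
-- required to be symmetric on edges
Colouring : ℕ → ℕ → Set
Colouring n m = Fin n → Fin n → Fin m

ColClass : ∀ {n m} → Graph n → Colouring n m → Fin m → Fin n → Fin n → Set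
ColClass G col i u v = Edge G u v × col u v ≡ i

Colourful : ∀ {n m} → Graph n → Colouring n m → Fin n → Set
Colourful G col v =
  ∀ x y → Edge G v x → Edge G v y → x ≢ y → col v x ≢ col v y

{-# OPTIONS --safe #-}
module Submission where

-- Build G vertex by vertex along its k-tree construction. Each vertex gets a label
-- in Fin (k+1), the labels forming a proper colouring, and an age; an edge takes the
-- label of its older endpoint. The older neighbours of every vertex form a clique, so
-- a vertex has at most one older neighbour of each label: each colour class is a
-- star-forest centred at the vertices of that label, and a vertex younger than all
-- its neighbours is colourful. A new simplicial vertex v takes a label missing from
-- its k neighbours and is placed right next to its youngest neighbour c, so the chord
-- vc crosses nothing. For any other neighbour b, an edge of colour label(b) crossing
-- vb would also cross the older edge cb of the same colour, unless it ends at c; but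
-- cb is the only edge of that colour at c. The other simplicial vertices of G are
-- non-neighbours of v and were already simplicial, hence colourful, before the step.

open import Defs hiding (sym)
open import Data.Bool using (Bool; true; false; T; if_then_else_)
open import Data.Bool.Properties using (T?)
open import Data.Empty using (⊥-elim)
open import Data.Fin using (Fin; zero; suc; punchIn; punchOut; toℕ; _≟_)
open import Data.Fin.Properties
  using (punchIn-injective; punchOut-injective; punchInᵢ≢i; punchIn-punchOut; toℕ-injective;
         cantor-schröder-bernstein; any?; all?; ¬∀⟶∃¬)
import Data.Fin.Properties as Fin
open import Data.Fin.Subset using (∣_∣)
open import Data.Fin.Subset.Properties using (∣p∣≤n)
open import Data.Nat using (ℕ; zero; suc; _*_; _≤_; _<_; _≥_; z≤n; s≤s; _<?_; _≤?_)
open import Data.Nat.Properties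
  using (≤-refl; ≤-reflexive; ≤-trans; <⇒≤; <⇒≱; ≰⇒>; ≤∧≢⇒<; <-trans; <-asym; <-irrefl; <-cmp;
         n≤1+n; n<1+n; 1+n≰n; ≤-pred; m≤n⇒m≤1+n; 0≢1+n; suc-injective;
         even≢odd; *-cancelˡ-≡; *-cancelˡ-<; *-monoʳ-<)
open import Data.Product using (Σ; ∃; _×_; _,_; proj₁; proj₂)
open import Data.Sum using (_⊎_; inj₁; inj₂)
open import Data.Vec using (tabulate)
open import Data.Vec.Functional using (insertAt)
open import Data.Vec.Functional.Properties using (insertAt-lookup; insertAt-punchIn)
open import Function using (_∘_; id)
open import Function.Bundles using (Inverse; Injection; Equivalence; _⇔_; mk⇔)
open import Function.Definitions using (Injective)
open import Function.Properties.Inverse using (↔⇒↣; ↔-sym)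
open import Relation.Binary using (tri<; tri≈; tri>)
open import Relation.Binary.PropositionalEquality using (_≡_; _≢_; refl; sym; trans; cong; subst; subst₂; ≢-sym)
open import Relation.Nullary using (¬_; Dec; yes; no; ¬?; _×-dec_)
open import Relation.Unary using (Pred; Decidable)

private variable
  n m : ℕ

-- Counting and searching in Fin n

∣tabulate∣-punchIn : ∀ (f : Fin (suc n) → Bool) v →
  ∣ tabulate f ∣ ≡ (if f v then suc else id) ∣ tabulate (f ∘ punchIn v) ∣
∣tabulate∣-punchIn f zero with f zero
... | true  = refl
... | false = refl
∣tabulate∣-punchIn {suc n} f (suc v) with f zero | f (suc v) | ∣tabulate∣-punchIn (f ∘ suc) v
... | true  | true  | eq = cong suc eq
... | true  | false | eq = cong suc eq
... | false | true  | eq = eq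
... | false | false | eq = eq

∣tabulate∣-punchIn-T : ∀ (f : Fin (suc n) → Bool) {v} → T (f v) →
  ∣ tabulate f ∣ ≡ suc ∣ tabulate (f ∘ punchIn v) ∣
∣tabulate∣-punchIn-T f {v} fv with f v | ∣tabulate∣-punchIn f v
... | true  | eq = eq
... | false | _  = ⊥-elim fv

∣tabulate∣-punchIn-F : ∀ (f : Fin (suc n) → Bool) {v} → ¬ T (f v) →
  ∣ tabulate f ∣ ≡ ∣ tabulate (f ∘ punchIn v) ∣
∣tabulate∣-punchIn-F f {v} ¬fv with f v | ∣tabulate∣-punchIn f v
... | true  | _  = ⊥-elim (¬fv _)
... | false | eq = eq

∣tabulate∣-punchIn-≤ : ∀ (f : Fin (suc n) → Bool) v →
  ∣ tabulate (f ∘ punchIn v) ∣ ≤ ∣ tabulate f ∣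
∣tabulate∣-punchIn-≤ f v with f v | ∣tabulate∣-punchIn f v
... | true  | eq = ≤-trans (n≤1+n _) (≤-reflexive (sym eq))
... | false | eq = ≤-reflexive (sym eq)

∣tabulate∣<n : ∀ (f : Fin n → Bool) {i} → ¬ T (f i) → ∣ tabulate f ∣ < n
∣tabulate∣<n {suc n} f ¬fi rewrite ∣tabulate∣-punchIn-F f ¬fi =
  s≤s (∣p∣≤n (tabulate (f ∘ punchIn _)))

∣tabulate∣<n∸1 : ∀ (f : Fin n → Bool) {i j} → i ≢ j → ¬ T (f i) → ¬ T (f j) →
  suc (suc ∣ tabulate f ∣) ≤ n
∣tabulate∣<n∸1 {suc n} f {i} {j} i≢j ¬fi ¬fj rewrite ∣tabulate∣-punchIn-F f ¬fi =
  s≤s (∣tabulate∣<n (f ∘ punchIn i) (subst (¬_ ∘ T ∘ f) (sym (punchIn-punchOut i≢j)) ¬fj))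

injective⇒≤∣tabulate∣ : ∀ (f : Fin n → Bool) {ψ : Fin m → Fin n} →
  Injective _≡_ _≡_ ψ → (∀ j → T (f (ψ j))) → m ≤ ∣ tabulate f ∣
injective⇒≤∣tabulate∣ {m = zero} f _ _ = z≤n
injective⇒≤∣tabulate∣ {zero} {suc m} f {ψ} _ _ with ψ zero
... | ()
injective⇒≤∣tabulate∣ {suc n} {suc m} f {ψ} ψ-injective fψ
  rewrite ∣tabulate∣-punchIn-T f (fψ zero) =
  s≤s (injective⇒≤∣tabulate∣ (f ∘ punchIn (ψ zero)) ψ′-injective fψ′)
  where
  ψ₀≢ψ : ∀ j → ψ zero ≢ ψ (suc j)
  ψ₀≢ψ j = Fin.0≢1+n ∘ ψ-injective
  ψ′ : Fin m → Fin n
  ψ′ j = punchOut (ψ₀≢ψ j)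
  ψ′-injective : Injective _≡_ _≡_ ψ′
  ψ′-injective eq = Fin.suc-injective (ψ-injective (punchOut-injective (ψ₀≢ψ _) (ψ₀≢ψ _) eq))
  fψ′ : ∀ j → T (f (punchIn (ψ zero) (ψ′ j)))
  fψ′ j = subst (T ∘ f) (sym (punchIn-punchOut (ψ₀≢ψ j))) (fψ (suc j))

missingLabel : ∀ (A : Fin n → Bool) (φ : Fin n → Fin m) → ∣ tabulate A ∣ < m →
  ∃ λ ℓ → ∀ {i} → T (A i) → φ i ≢ ℓ
missingLabel {n} {m} A φ few = decide (all? used?)
  where
  Used : Fin m → Set
  Used ℓ = ∃ λ i → T (A i) × φ i ≡ ℓ
  used? : Decidable Used
  used? ℓ = any? (λ i → T? (A i) ×-dec φ i ≟ ℓ)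
  decide : Dec (∀ ℓ → Used ℓ) → ∃ λ ℓ → ∀ {i} → T (A i) → φ i ≢ ℓ
  decide (yes used) =
    ⊥-elim (<⇒≱ few (injective⇒≤∣tabulate∣ A ψ-injective (proj₁ ∘ proj₂ ∘ used)))
    where
    ψ-injective : Injective _≡_ _≡_ (proj₁ ∘ used)
    ψ-injective {ℓ} {ℓ′} eq =
      trans (sym (proj₂ (proj₂ (used ℓ)))) (trans (cong φ eq) (proj₂ (proj₂ (used ℓ′))))
  decide (no unused) with ¬∀⟶∃¬ m Used used? unused
  ... | ℓ , free = ℓ , λ Ai φi≡ℓ → free (_ , Ai , φi≡ℓ)

someWitness : ∀ {p} {P : Pred (Fin n) p} → Decidable P → Fin n → Σ (Fin n) λ w → ∃ P → P w
someWitness P? default with any? P?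
... | yes (w , pw) = w , λ _ → pw
... | no none      = default , λ ex → ⊥-elim (none ex)

argmin? : ∀ {p} {P : Pred (Fin n) p} → Decidable P → (f : Fin n → ℕ) →
  (∃ λ c → P c × ∀ {x} → P x → f c ≤ f x) ⊎ (∀ x → ¬ P x)
argmin? {zero} P? f = inj₂ λ ()
argmin? {suc n} P? f with P? zero | argmin? (P? ∘ suc) (f ∘ suc)
... | no ¬p₀ | inj₂ none = inj₂ λ { zero → ¬p₀ ; (suc x) → none x }
... | yes p₀ | inj₂ none =
  inj₁ (zero , p₀ , λ { {zero} _ → ≤-refl ; {suc x} px → ⊥-elim (none x px) })
... | no ¬p₀ | inj₁ (c , pc , min) =
  inj₁ (suc c , pc , λ { {zero} p₀ → ⊥-elim (¬p₀ p₀) ; {suc x} px → min px })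
... | yes p₀ | inj₁ (c , pc , min) with f zero ≤? f (suc c)
...   | yes f₀≤ = inj₁ (zero , p₀ , λ { {zero} _ → ≤-refl ; {suc x} px → ≤-trans f₀≤ (min px) })
...   | no f₀≰  = inj₁ (suc c , pc , λ { {zero} _ → <⇒≤ (≰⇒> f₀≰) ; {suc x} px → min px })

-- Points in convex position

Between-sym : ∀ {a x b} → Between a x b → Between b x a
Between-sym (inj₁ p) = inj₂ p
Between-sym (inj₂ p) = inj₁ p

¬Between-suc : ∀ {a x} → ¬ Between a x (suc a)
¬Between-suc (inj₁ (a<x , x<1+a)) = <-irrefl refl (≤-trans a<x (≤-pred x<1+a))
¬Between-suc {a} (inj₂ (1+a<x , x<a)) = <-asym (<-trans (n<1+n a) 1+a<x) x<a

between-shift : ∀ {u w x b} → ¬ Between u x w → x ≢ u → Between w x b → Between u x b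
between-shift {u} {x = x} ¬uxw x≢u (inj₁ (w<x , x<b)) with <-cmp u x
... | tri< u<x _ _ = inj₁ (u<x , x<b)
... | tri≈ _ u≡x _ = ⊥-elim (x≢u (sym u≡x))
... | tri> _ _ x<u = ⊥-elim (¬uxw (inj₂ (w<x , x<u)))
between-shift {u} {x = x} ¬uxw x≢u (inj₂ (b<x , x<w)) with <-cmp u x
... | tri< u<x _ _ = ⊥-elim (¬uxw (inj₁ (u<x , x<w)))
... | tri≈ _ u≡x _ = ⊥-elim (x≢u (sym u≡x))
... | tri> _ _ x<u = inj₂ (b<x , x<u)

between-map : ∀ {X : Set} {p q : X → ℕ} → (∀ {x y} → q x < q y → p x < p y) →
  ∀ {a x b} → Between (q a) (q x) (q b) → Between (p a) (p x) (p b)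
between-map mono (inj₁ (l , r)) = inj₁ (mono l , mono r)
between-map mono (inj₂ (l , r)) = inj₂ (mono l , mono r)

-- The chord ab separates c from d; this is the last component of Cross, on positions.
Separates : ℕ → ℕ → ℕ → ℕ → Set
Separates a b c d = (Between a c b × ¬ Between a d b) ⊎ (Between a d b × ¬ Between a c b)

separates-resp : ∀ {a b c d a′ b′ c′ d′} →
  Between a c b ⇔ Between a′ c′ b′ → Between a d b ⇔ Between a′ d′ b′ →
  Separates a b c d → Separates a′ b′ c′ d′
separates-resp c⇔ d⇔ (inj₁ (c∈ , d∉)) =
  inj₁ (Equivalence.to c⇔ c∈ , d∉ ∘ Equivalence.from d⇔)
separates-resp c⇔ d⇔ (inj₂ (d∈ , c∉)) =
  inj₂ (Equivalence.to d⇔ d∈ , c∉ ∘ Equivalence.from c⇔)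

separates-swapˡ : ∀ {a b c d} → Separates a b c d → Separates b a c d
separates-swapˡ = separates-resp (mk⇔ Between-sym Between-sym) (mk⇔ Between-sym Between-sym)

separates-swapʳ : ∀ {a b c d} → Separates a b c d → Separates a b d c
separates-swapʳ (inj₁ p) = inj₂ p
separates-swapʳ (inj₂ p) = inj₁ p

separates-sym-< : ∀ {a b c d} → a < c → c < b → d ≢ a → d ≢ b → ¬ Between a d b →
  Separates c d a b
separates-sym-< {a} {b} {c} {d} a<c c<b d≢a d≢b ¬adb with <-cmp d a
... | tri< d<a _ _ = inj₁ (inj₂ (d<a , a<c) , λ
      { (inj₁ (_ , b<d)) → <-asym (<-trans d<a (<-trans a<c c<b)) b<d
      ; (inj₂ (_ , b<c)) → <-asym c<b b<c })
... | tri≈ _ d≡a _ = ⊥-elim (d≢a d≡a)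
... | tri> _ _ a<d with <-cmp d b
...   | tri< d<b _ _ = ⊥-elim (¬adb (inj₁ (a<d , d<b)))
...   | tri≈ _ d≡b _ = ⊥-elim (d≢b d≡b)
...   | tri> _ _ b<d = inj₂ (inj₁ (c<b , b<d) , λ
        { (inj₁ (c<a , _)) → <-asym a<c c<a
        ; (inj₂ (d<a , _)) → <-asym a<d d<a })

separates-sym₁ : ∀ {a b c d} → a ≢ d → b ≢ d → Between a c b → ¬ Between a d b →
  Separates c d a b
separates-sym₁ a≢d b≢d (inj₁ (a<c , c<b)) ¬adb =
  separates-sym-< a<c c<b (≢-sym a≢d) (≢-sym b≢d) ¬adb
separates-sym₁ a≢d b≢d (inj₂ (b<c , c<a)) ¬adb =
  separates-swapʳ (separates-sym-< b<c c<a (≢-sym b≢d) (≢-sym a≢d) (¬adb ∘ Between-sym))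

separates-sym : ∀ {a b c d} → a ≢ c → a ≢ d → b ≢ c → b ≢ d →
  Separates a b c d → Separates c d a b
separates-sym _ a≢d _ b≢d (inj₁ (c∈ , d∉)) = separates-sym₁ a≢d b≢d c∈ d∉
separates-sym a≢c _ b≢c _ (inj₂ (d∈ , c∉)) = separates-swapˡ (separates-sym₁ a≢c b≢c d∈ c∉)

module _ (β : BookEmbedding n) where
  private
    pos = proj₁ β
    pos-injective = proj₂ β

  cross-flipˡ : ∀ {a b c d} → Cross β a b c d → Cross β b a c d
  cross-flipˡ (a≢c , a≢d , b≢c , b≢d , sep) = b≢c , b≢d , a≢c , a≢d , separates-swapˡ sep

  cross-sym : ∀ {a b c d} → Cross β a b c d → Cross β c d a b
  cross-sym (a≢c , a≢d , b≢c , b≢d , sep) =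
    ≢-sym a≢c , ≢-sym b≢c , ≢-sym a≢d , ≢-sym b≢d ,
    separates-sym (a≢c ∘ pos-injective) (a≢d ∘ pos-injective)
                  (b≢c ∘ pos-injective) (b≢d ∘ pos-injective) sep

  Consecutive : Fin n → Fin n → Set
  Consecutive u w = ∀ x → ¬ Between (pos u) (pos x) (pos w)

  consecutive-sym : ∀ {u w} → Consecutive u w → Consecutive w u
  consecutive-sym uw x = uw x ∘ Between-sym

  consecutive⇒¬cross : ∀ {u w c d} → Consecutive u w → ¬ Cross β u w c d
  consecutive⇒¬cross uw (_ , _ , _ , _ , inj₁ (c∈ , _)) = uw _ c∈
  consecutive⇒¬cross uw (_ , _ , _ , _ , inj₂ (d∈ , _)) = uw _ d∈

  cross-shift : ∀ {u w b c d} → Consecutive u w → c ≢ u → d ≢ u →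
    Cross β w b c d → Cross β u b c d
  cross-shift {u} {w} {b} uw c≢u d≢u (w≢c , w≢d , b≢c , b≢d , sep) =
    ≢-sym c≢u , ≢-sym d≢u , b≢c , b≢d , separates-resp (shift w≢c c≢u) (shift w≢d d≢u) sep
    where
    shift : ∀ {x} → w ≢ x → x ≢ u →
      Between (pos w) (pos x) (pos b) ⇔ Between (pos u) (pos x) (pos b)
    shift {x} w≢x x≢u = mk⇔ (between-shift (uw x) (x≢u ∘ pos-injective))
                            (between-shift (consecutive-sym uw x) (w≢x ∘ sym ∘ pos-injective))

cross-reflect : ∀ (β : BookEmbedding m) (β′ : BookEmbedding n) (h : Fin m → Fin n) →
  (∀ {x y} → proj₁ β x < proj₁ β y ⇔ proj₁ β′ (h x) < proj₁ β′ (h y)) →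
  ∀ {a b c d} → Cross β′ (h a) (h b) (h c) (h d) → Cross β a b c d
cross-reflect β β′ h order (a≢c , a≢d , b≢c , b≢d , sep) =
  a≢c ∘ cong h , a≢d ∘ cong h , b≢c ∘ cong h , b≢d ∘ cong h , separates-resp reflect reflect sep
  where
  reflect : ∀ {a x b} → Between (proj₁ β′ (h a)) (proj₁ β′ (h x)) (proj₁ β′ (h b)) ⇔
                        Between (proj₁ β a) (proj₁ β x) (proj₁ β b)
  reflect = mk⇔ (between-map {q = proj₁ β′ ∘ h} (Equivalence.from order))
                (between-map {p = proj₁ β′ ∘ h} (Equivalence.to order))

Edge-irrefl : ∀ (G : Graph n) {u} → ¬ Edge G u u
Edge-irrefl G {u} = subst T (irref G u)

Edge-sym : ∀ (G : Graph n) {u x} → Edge G u x → Edge G x u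
Edge-sym G {u} {x} = subst T (Graph.sym G u x)

Edge⇒≢ : ∀ (G : Graph n) {u x} → Edge G u x → u ≢ x
Edge⇒≢ G e refl = Edge-irrefl G e

degree : Graph n → Fin n → ℕ
degree G u = ∣ N G u ∣

module _ (G : Graph (suc n)) {v : Fin (suc n)} where

  degree-punchIn-T : ∀ {i} → Edge G (punchIn v i) v →
    degree G (punchIn v i) ≡ suc (degree (delete G v) i)
  degree-punchIn-T = ∣tabulate∣-punchIn-T (adj G _)

  degree-punchIn-F : ∀ {i} → ¬ Edge G (punchIn v i) v →
    degree G (punchIn v i) ≡ degree (delete G v) i
  degree-punchIn-F = ∣tabulate∣-punchIn-F (adj G _)

  degree-deleted : degree G v ≡ ∣ tabulate (adj G v ∘ punchIn v) ∣
  degree-deleted = ∣tabulate∣-punchIn-F (adj G v) (Edge-irrefl G)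

data InsertView (v : Fin (suc n)) : Fin (suc n) → Set where
  inserted : InsertView v v
  kept     : ∀ i → InsertView v (punchIn v i)

insertView : ∀ (v x : Fin (suc n)) → InsertView v x
insertView v x with v ≟ x
... | yes refl = inserted
... | no v≢x   = subst (InsertView v) (punchIn-punchOut v≢x) (kept (punchOut v≢x))

K-edge : ∀ {a b : Fin m} → a ≢ b → Edge (K m) a b
K-edge {a = zero}  {zero}  a≢b = a≢b refl
K-edge {a = zero}  {suc b} _   = _
K-edge {a = suc a} {zero}  _   = _
K-edge {a = suc a} {suc b} a≢b = K-edge (a≢b ∘ cong suc)

≅K⇒≡ : ∀ {G : Graph n} → G ≅ K m → n ≡ m
≅K⇒≡ (f , _) =
  cantor-schröder-bernstein (Injection.injective (↔⇒↣ f)) (Injection.injective (↔⇒↣ (↔-sym f)))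

≅K⇒Edge : ∀ {G : Graph n} → G ≅ K m → ∀ {u x} → u ≢ x → Edge G u x
≅K⇒Edge {m = m} (f , adj≡) {u} {x} u≢x =
  subst T (sym (adj≡ u x))
    (K-edge {m} {Inverse.to f u} {Inverse.to f x} (u≢x ∘ Injection.injective (↔⇒↣ f)))

module _ {k : ℕ} where

  KTree-size : ∀ {G : Graph n} → KTree k G → suc k ≤ n
  KTree-size (base G iso)   = ≤-reflexive (sym (≅K⇒≡ {G = G} iso))
  KTree-size (step G v _ d) = m≤n⇒m≤1+n (KTree-size d)

  KTree-vertex : ∀ {G : Graph n} → KTree k G → Fin n
  KTree-vertex d with KTree-size d
  ... | s≤s _ = zero

  KTree-step-≇ : ∀ {G : Graph (suc n)} {v} → KTree k (delete G v) → ¬ G ≅ K (suc k)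
  KTree-step-≇ {G = G} d iso = <-irrefl (sym (≅K⇒≡ {G = G} iso)) (s≤s (KTree-size d))

  KTree-complete? : ∀ {G : Graph n} → KTree k G → Dec (G ≅ K (suc k))
  KTree-complete? (base G iso)   = yes iso
  KTree-complete? (step G v _ d) = no (KTree-step-≇ {G = G} d)

  KTree-degree : ∀ {G : Graph n} → KTree k G → ∀ u → k ≤ degree G u
  KTree-degree (base G iso@(f , _)) u = injective⇒≤∣tabulate∣ (adj G u) ψ-injective ψ-adjacent
    where
    ψ : Fin k → Fin _
    ψ j = Inverse.from f (punchIn (Inverse.to f u) j)
    ψ-injective : Injective _≡_ _≡_ ψ
    ψ-injective = punchIn-injective _ _ _ ∘ Injection.injective (↔⇒↣ (↔-sym f))
    ψ-adjacent : ∀ j → Edge G u (ψ j)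
    ψ-adjacent j = ≅K⇒Edge {G = G} iso λ u≡ψj →
      punchInᵢ≢i _ j (sym (trans (cong (Inverse.to f) u≡ψj) (Inverse.strictlyInverseˡ f _)))
  KTree-degree (step G v (deg , _) d) u with insertView v u
  ... | inserted = ≤-reflexive (sym deg)
  ... | kept i   = ≤-trans (KTree-degree d i) (∣tabulate∣-punchIn-≤ (adj G (punchIn v i)) v)

  simplicial-delete : ∀ (G : Graph (suc n)) {v i} → ¬ Edge G (punchIn v i) v →
    Simplicial k G (punchIn v i) → Simplicial k (delete G v) i
  simplicial-delete G {v} ¬e (deg , clique) =
    trans (sym (degree-punchIn-F G ¬e)) deg ,
    λ x y ex ey x≢y → clique _ _ ex ey (x≢y ∘ punchIn-injective v x y)

  neighbour-¬simplicial : ∀ (G : Graph (suc n)) {v i} → Edge G (punchIn v i) v →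
    k ≤ degree (delete G v) i → ¬ Simplicial k G (punchIn v i)
  neighbour-¬simplicial G e k≤ (deg , _) =
    1+n≰n (subst (_≤ _) (trans (sym deg) (degree-punchIn-T G e)) k≤)

  nonNeighbour-unique : ∀ (G : Graph (suc n)) {v} → delete G v ≅ K (suc k) → Simplicial k G v →
    ∀ {i j} → ¬ Edge G v (punchIn v i) → ¬ Edge G v (punchIn v j) → i ≡ j
  nonNeighbour-unique {n} G {v} iso (deg , _) {i} {j} ¬vi ¬vj with i ≟ j
  ... | yes i≡j = i≡j
  ... | no i≢j  = ⊥-elim (1+n≰n (subst₂ _≤_ (cong (λ (d : ℕ) → suc (suc d)) neighbours≡k)
                                             (≅K⇒≡ {G = delete G v} iso) two-missing))
    where
    neighbours≡k : ∣ tabulate (adj G v ∘ punchIn v) ∣ ≡ k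
    neighbours≡k = trans (sym (degree-deleted G)) deg
    two-missing : suc (suc ∣ tabulate (adj G v ∘ punchIn v) ∣) ≤ n
    two-missing = ∣tabulate∣<n∸1 (adj G v ∘ punchIn v) i≢j ¬vi ¬vj

-- Layouts: edges coloured by their older endpoint

edgeColour : (Fin n → ℕ) → (Fin n → Fin m) → Colouring n m
edgeColour age label u x with age u <? age x
... | yes _ = label x
... | no _  = label u

module _ {age : Fin n → ℕ} {label : Fin n → Fin m} where

  edgeColour-older : ∀ {u x} → age u < age x → edgeColour age label u x ≡ label x
  edgeColour-older {u} {x} u<x with age u <? age x
  ... | yes _   = refl
  ... | no u≮x = ⊥-elim (u≮x u<x)

  edgeColour-younger : ∀ {u x} → age x < age u → edgeColour age label u x ≡ label u
  edgeColour-younger {u} {x} x<u with age u <? age x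
  ... | yes u<x = ⊥-elim (<-asym x<u u<x)
  ... | no _    = refl

  edgeColour-endpoint : ∀ u x →
    edgeColour age label u x ≡ label u ⊎ edgeColour age label u x ≡ label x
  edgeColour-endpoint u x with age u <? age x
  ... | yes _ = inj₂ refl
  ... | no _  = inj₁ refl

  edgeColour-sym : ∀ {u x} → age u ≢ age x → edgeColour age label u x ≡ edgeColour age label x u
  edgeColour-sym {u} {x} u≢x with <-cmp (age u) (age x)
  ... | tri< u<x _ _ = trans (edgeColour-older u<x) (sym (edgeColour-younger u<x))
  ... | tri≈ _ u≡x _ = ⊥-elim (u≢x u≡x)
  ... | tri> _ _ x<u = trans (edgeColour-younger x<u) (sym (edgeColour-older x<u))

edgeColour-cong : ∀ {n′} {age : Fin n → ℕ} {label : Fin n → Fin m}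
  {age′ : Fin n′ → ℕ} {label′ : Fin n′ → Fin m} {u x u′ x′} →
  age u < age x ⇔ age′ u′ < age′ x′ → label u ≡ label′ u′ → label x ≡ label′ x′ →
  edgeColour age label u x ≡ edgeColour age′ label′ u′ x′
edgeColour-cong {age = age} {age′ = age′} {u = u} {x} {u′} {x′} order lu lx
  with age u <? age x | age′ u′ <? age′ x′
... | yes _   | yes _    = lx
... | no _    | no _     = lu
... | yes u<x | no u′≮x′ = ⊥-elim (u′≮x′ (Equivalence.to order u<x))
... | no u≮x  | yes u′<x′ = ⊥-elim (u≮x (Equivalence.from order u′<x′))

record Layout (m : ℕ) (G : Graph n) : Set where
  field
    label         : Fin n → Fin m
    age           : Fin n → ℕ
    pos           : Fin n → ℕ
    age-injective : Injective _≡_ _≡_ age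
    pos-injective : Injective _≡_ _≡_ pos
    label-proper  : ∀ {u x} → Edge G u x → label u ≢ label x
    older-clique  : ∀ {u x y} → Edge G u x → Edge G u y → age u < age x → age u < age y →
                    x ≢ y → Edge G x y
    noCross       : ∀ {a b c d} → Edge G a b → Edge G c d →
                    edgeColour age label a b ≡ edgeColour age label c d →
                    ¬ Cross (pos , pos-injective) a b c d

  colour : Colouring n m
  colour = edgeColour age label

  embedding : BookEmbedding n
  embedding = pos , pos-injective

module _ {G : Graph n} (L : Layout m G) where
  open Layout L

  colour-older : ∀ {u x} → age u < age x → colour u x ≡ label x
  colour-older = edgeColour-older {age = age} {label}

  colour-younger : ∀ {u x} → age x < age u → colour u x ≡ label u
  colour-younger = edgeColour-younger {age = age} {label}

  colour-sym : ∀ {u x} → Edge G u x → colour u x ≡ colour x u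
  colour-sym e = edgeColour-sym {age = age} {label} (Edge⇒≢ G e ∘ age-injective)

  older-unique : ∀ {u x y} → Edge G u x → Edge G u y → age u < age x → age u < age y →
    label x ≡ label y → x ≡ y
  older-unique {x = x} {y} ux uy u<x u<y lx≡ly with x ≟ y
  ... | yes x≡y = x≡y
  ... | no x≢y  = ⊥-elim (label-proper (older-clique ux uy u<x u<y x≢y) lx≡ly)

  colour≡label⇒older : ∀ {u x} → Edge G u x → colour u x ≡ label x → age u < age x
  colour≡label⇒older ux c≡lx with <-cmp (age _) (age _)
  ... | tri< u<x _ _ = u<x
  ... | tri≈ _ u≡x _ = ⊥-elim (Edge⇒≢ G ux (age-injective u≡x))
  ... | tri> _ _ x<u = ⊥-elim (label-proper ux (trans (sym (colour-younger x<u)) c≡lx))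

  neighbour-unique : ∀ {u x y} → Edge G u x → Edge G u y → age u < age x →
    colour u y ≡ label x → y ≡ x
  neighbour-unique {u} {x} {y} ux uy u<x cy≡lx with <-cmp (age u) (age y)
  ... | tri< u<y _ _ =
        sym (older-unique ux uy u<x u<y (sym (trans (sym (colour-older u<y)) cy≡lx)))
  ... | tri≈ _ u≡y _ = ⊥-elim (Edge⇒≢ G uy (age-injective u≡y))
  ... | tri> _ _ y<u = ⊥-elim (label-proper ux (trans (sym (colour-younger y<u)) cy≡lx))

  youngest-colourful : ∀ {w} → (∀ {x} → Edge G w x → age w < age x) → Colourful G colour w
  youngest-colourful young x y wx wy x≢y cx≡cy =
    label-proper (older-clique wx wy (young wx) (young wy) x≢y)
      (trans (sym (colour-older (young wx))) (trans cx≡cy (colour-older (young wy))))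

  module _ (i : Fin m) where
    private
      Class = ColClass G colour i

    class-sym : ∀ {x y} → Class x y → Class y x
    class-sym (xy , cxy) = Edge-sym G xy , trans (sym (colour-sym xy)) cxy

    class-centre : ∀ {c x y} → label c ≡ i → Class c x → Class x y → y ≡ c
    class-centre lc (cx , ccx) (xy , cxy) = neighbour-unique xc xy x<c (trans cxy (sym lc))
      where
      xc = Edge-sym G cx
      x<c = colour≡label⇒older xc (trans (sym (colour-sym cx)) (trans ccx (sym lc)))

    Star : Fin n → Fin n → Set
    Star c x = x ≡ c ⊎ Class c x

    star-step : ∀ {c x y} → label c ≡ i → Star c x → Class x y → Star c y
    star-step lc (inj₁ refl) cy = inj₂ cy
    star-step lc (inj₂ cx)   xy = inj₁ (class-centre lc cx xy)

    star-reach : ∀ {c x y} → label c ≡ i → Star c x → Reach Class x y → Star c y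
    star-reach lc s here        = s
    star-reach lc s (there e r) = star-reach lc (star-step lc s e) r

    star-edge : ∀ {c x y} → label c ≡ i → Star c x → Class x y → c ≡ x ⊎ c ≡ y
    star-edge lc (inj₁ refl) _  = inj₁ refl
    star-edge lc (inj₂ cx)   xy = inj₂ (sym (class-centre lc cx xy))

    starForest : StarForest Class
    starForest u w (uw , cuw) with edgeColour-endpoint {age = age} {label} u w
    ... | inj₁ cuw≡lu = u , inj₁ refl , λ _ _ xy r → star-edge lu (star-reach lu (inj₁ refl) r) xy
      where lu = trans (sym cuw≡lu) cuw
    ... | inj₂ cuw≡lw = w , inj₂ refl , λ _ _ xy r →
            star-edge lw (star-reach lw (inj₂ (class-sym (uw , cuw))) r) xy
      where lw = trans (sym cuw≡lw) cuw

module CompleteLayout {G : Graph n} (iso : G ≅ K m) (w : Fin n) where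

  label : Fin n → Fin m
  label = Inverse.to (proj₁ iso)

  label-injective : Injective _≡_ _≡_ label
  label-injective = Injection.injective (↔⇒↣ (proj₁ iso))

  age : Fin n → ℕ
  age x with x ≟ w
  ... | yes _ = 0
  ... | no _  = suc (toℕ x)

  age-injective : Injective _≡_ _≡_ age
  age-injective {x} {y} eq with x ≟ w | y ≟ w
  ... | yes x≡w | yes y≡w = trans x≡w (sym y≡w)
  ... | yes _   | no _    = ⊥-elim (0≢1+n eq)
  ... | no _    | yes _   = ⊥-elim (0≢1+n (sym eq))
  ... | no _    | no _    = toℕ-injective (suc-injective eq)

  w-youngest : ∀ {x} → Edge G w x → age w < age x
  w-youngest {x} wx with w ≟ w | x ≟ w
  ... | no w≢w | _       = ⊥-elim (w≢w refl)
  ... | yes _  | yes x≡w = ⊥-elim (Edge⇒≢ G wx (sym x≡w))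
  ... | yes _  | no _    = s≤s z≤n

  noCross : ∀ {a b c d} → Edge G a b → Edge G c d →
    edgeColour age label a b ≡ edgeColour age label c d →
    ¬ Cross (toℕ , toℕ-injective) a b c d
  noCross {a} {b} {c} {d} _ _ eq (a≢c , a≢d , b≢c , b≢d , _)
    with edgeColour-endpoint {age = age} {label} a b | edgeColour-endpoint {age = age} {label} c d
  ... | inj₁ ca | inj₁ cc = a≢c (label-injective (trans (sym ca) (trans eq cc)))
  ... | inj₁ ca | inj₂ cd = a≢d (label-injective (trans (sym ca) (trans eq cd)))
  ... | inj₂ cb | inj₁ cc = b≢c (label-injective (trans (sym cb) (trans eq cc)))
  ... | inj₂ cb | inj₂ cd = b≢d (label-injective (trans (sym cb) (trans eq cd)))

  layout : Layout m G
  layout = record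
    { label         = label
    ; age           = age
    ; pos           = toℕ
    ; age-injective = age-injective
    ; pos-injective = toℕ-injective
    ; label-proper  = λ e → Edge⇒≢ G e ∘ label-injective
    ; older-clique  = λ _ _ _ _ → ≅K⇒Edge {G = G} iso
    ; noCross       = noCross
    }

  w-colourful : Colourful G (Layout.colour layout) w
  w-colourful = youngest-colourful layout w-youngest

module Extension {G : Graph (suc n)} {v : Fin (suc n)}
  (v-clique : ∀ x y → Edge G v x → Edge G v y → x ≢ y → Edge G x y)
  (L : Layout m (delete G v)) {c : Fin n}
  (c-youngest : ∀ {x} → Edge G v (punchIn v x) →
                Edge G v (punchIn v c) × Layout.age L c ≤ Layout.age L x)
  {ℓ : Fin m} (ℓ-missing : ∀ {x} → Edge G v (punchIn v x) → Layout.label L x ≢ ℓ) where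

  open Layout L

  private
    G′ = delete G v
    P  = punchIn v
    P-injective : ∀ {i j} → P i ≡ P j → i ≡ j
    P-injective = punchIn-injective v _ _

  labelᴺ : Fin (suc n) → Fin m
  labelᴺ = insertAt label v ℓ

  ageᴺ : Fin (suc n) → ℕ
  ageᴺ = insertAt (suc ∘ age) v 0

  -- Doubling the old positions leaves the slot 2·pos c + 1, right after c, for v.
  posᴺ : Fin (suc n) → ℕ
  posᴺ = insertAt (λ i → 2 * pos i) v (suc (2 * pos c))

  colourᴺ : Colouring (suc n) m
  colourᴺ = edgeColour ageᴺ labelᴺ

  ageᴺ-v : ageᴺ v ≡ 0
  ageᴺ-v = insertAt-lookup (suc ∘ age) v 0

  ageᴺ-P : ∀ i → ageᴺ (P i) ≡ suc (age i)
  ageᴺ-P = insertAt-punchIn (suc ∘ age) v 0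

  labelᴺ-v : labelᴺ v ≡ ℓ
  labelᴺ-v = insertAt-lookup label v ℓ

  labelᴺ-P : ∀ i → labelᴺ (P i) ≡ label i
  labelᴺ-P = insertAt-punchIn label v ℓ

  posᴺ-v : posᴺ v ≡ suc (2 * pos c)
  posᴺ-v = insertAt-lookup (λ i → 2 * pos i) v (suc (2 * pos c))

  posᴺ-P : ∀ i → posᴺ (P i) ≡ 2 * pos i
  posᴺ-P = insertAt-punchIn (λ i → 2 * pos i) v (suc (2 * pos c))

  v-youngest : ∀ i → ageᴺ v < ageᴺ (P i)
  v-youngest i rewrite ageᴺ-v | ageᴺ-P i = s≤s z≤n

  ageᴺ-injective : Injective _≡_ _≡_ ageᴺ
  ageᴺ-injective {x} {y} eq with insertView v x | insertView v y
  ... | inserted | inserted = refl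
  ... | inserted | kept j   = ⊥-elim (<-irrefl eq (v-youngest j))
  ... | kept i   | inserted = ⊥-elim (<-irrefl (sym eq) (v-youngest i))
  ... | kept i   | kept j   =
        cong P (age-injective (suc-injective (trans (sym (ageᴺ-P i)) (trans eq (ageᴺ-P j)))))

  posᴺ-injective : Injective _≡_ _≡_ posᴺ
  posᴺ-injective {x} {y} eq with insertView v x | insertView v y
  ... | inserted | inserted = refl
  ... | inserted | kept j   =
        ⊥-elim (even≢odd (pos j) (pos c) (trans (sym (posᴺ-P j)) (trans (sym eq) posᴺ-v)))
  ... | kept i   | inserted =
        ⊥-elim (even≢odd (pos i) (pos c) (trans (sym (posᴺ-P i)) (trans eq posᴺ-v)))
  ... | kept i   | kept j   =
        cong P (pos-injective (*-cancelˡ-≡ _ _ 2 (trans (sym (posᴺ-P i)) (trans eq (posᴺ-P j)))))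

  embeddingᴺ : BookEmbedding (suc n)
  embeddingᴺ = posᴺ , posᴺ-injective

  labelᴺ-proper : ∀ {x y} → Edge G x y → labelᴺ x ≢ labelᴺ y
  labelᴺ-proper {x} {y} xy with insertView v x | insertView v y
  ... | inserted | inserted = ⊥-elim (Edge-irrefl G xy)
  ... | inserted | kept j   = λ eq →
        ℓ-missing xy (trans (sym (labelᴺ-P j)) (trans (sym eq) labelᴺ-v))
  ... | kept i   | inserted = λ eq →
        ℓ-missing (Edge-sym G xy) (trans (sym (labelᴺ-P i)) (trans eq labelᴺ-v))
  ... | kept i   | kept j   = λ eq →
        label-proper xy (trans (sym (labelᴺ-P i)) (trans eq (labelᴺ-P j)))

  ageᴺ-P-< : ∀ {i j} → ageᴺ (P i) < ageᴺ (P j) ⇔ age i < age j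
  ageᴺ-P-< {i} {j} rewrite ageᴺ-P i | ageᴺ-P j = mk⇔ ≤-pred s≤s

  older-cliqueᴺ : ∀ {u x y} → Edge G u x → Edge G u y → ageᴺ u < ageᴺ x → ageᴺ u < ageᴺ y →
    x ≢ y → Edge G x y
  older-cliqueᴺ {u} {x} {y} ux uy u<x u<y x≢y with insertView v u
  ... | inserted = v-clique x y ux uy x≢y
  ... | kept i with insertView v x | insertView v y
  ...   | inserted | _        = ⊥-elim (<-asym u<x (v-youngest i))
  ...   | kept _   | inserted = ⊥-elim (<-asym u<y (v-youngest i))
  ...   | kept j   | kept l   =
          older-clique ux uy (Equivalence.to ageᴺ-P-< u<x) (Equivalence.to ageᴺ-P-< u<y) (x≢y ∘ cong P)

  posᴺ-P-< : ∀ {i j} → pos i < pos j ⇔ posᴺ (P i) < posᴺ (P j)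
  posᴺ-P-< {i} {j} rewrite posᴺ-P i | posᴺ-P j = mk⇔ (*-monoʳ-< 2) (*-cancelˡ-< 2 _ _)

  colourᴺ-P : ∀ i j → colourᴺ (P i) (P j) ≡ colour i j
  colourᴺ-P i j = edgeColour-cong {age = ageᴺ} {labelᴺ} {age′ = age} {label′ = label}
    ageᴺ-P-< (labelᴺ-P i) (labelᴺ-P j)

  colourᴺ-v : ∀ i → colourᴺ v (P i) ≡ label i
  colourᴺ-v i = trans (edgeColour-older {age = ageᴺ} {labelᴺ} (v-youngest i)) (labelᴺ-P i)

  colourᴺ-sym : ∀ {x y} → Edge G x y → colourᴺ x y ≡ colourᴺ y x
  colourᴺ-sym xy = edgeColour-sym {age = ageᴺ} {labelᴺ} (Edge⇒≢ G xy ∘ ageᴺ-injective)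

  P-reflects-cross : ∀ {a b x y} → Cross embeddingᴺ (P a) (P b) (P x) (P y) →
    Cross embedding a b x y
  P-reflects-cross = cross-reflect embedding embeddingᴺ P posᴺ-P-<

  c-v-consecutive : Consecutive embeddingᴺ (P c) v
  c-v-consecutive x rewrite posᴺ-P c | posᴺ-v = ¬Between-suc

  older-neighbour : ∀ {b} → Edge G v (P b) → b ≢ c → Edge G′ c b × age c < age b
  older-neighbour vb b≢c with c-youngest vb
  ... | vc , c≤b =
        v-clique _ _ vc vb (b≢c ∘ sym ∘ P-injective) , ≤∧≢⇒< c≤b (b≢c ∘ sym ∘ age-injective)

  new-old-¬cross : ∀ {b x y} → Edge G v (P b) → Edge G′ x y → label b ≡ colour x y →
    ¬ Cross embeddingᴺ v (P b) (P x) (P y)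
  new-old-¬cross {b} {x} {y} vb xy lb≡cxy cr@(_ , _ , b≢x , b≢y , _) with b ≟ c
  ... | yes refl = consecutive⇒¬cross embeddingᴺ (consecutive-sym embeddingᴺ c-v-consecutive) cr
  ... | no b≢c with older-neighbour vb b≢c | x ≟ c | y ≟ c
  ...   | cb , c<b | yes refl | _ = b≢y (cong P (sym (neighbour-unique L cb xy c<b (sym lb≡cxy))))
  ...   | cb , c<b | no _ | yes refl =
          b≢x (cong P (sym (neighbour-unique L cb yx c<b (trans (colour-sym L yx) (sym lb≡cxy)))))
    where yx = Edge-sym G′ xy
  ...   | cb , c<b | no x≢c | no y≢c =
          noCross cb xy (trans (colour-older L c<b) lb≡cxy) (P-reflects-cross cb-crosses)
    where
    cb-crosses : Cross embeddingᴺ (P c) (P b) (P x) (P y)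
    cb-crosses = cross-shift embeddingᴺ c-v-consecutive (x≢c ∘ P-injective) (y≢c ∘ P-injective) cr

  new-¬cross : ∀ {b x y} → Edge G v (P b) → Edge G x y → colourᴺ v (P b) ≡ colourᴺ x y →
    ¬ Cross embeddingᴺ v (P b) x y
  new-¬cross {x = x} {y} vb xy eq cr with insertView v x | insertView v y
  ... | inserted | _        = proj₁ cr refl
  ... | kept _   | inserted = proj₁ (proj₂ cr) refl
  ... | kept i   | kept j   =
        new-old-¬cross vb xy (trans (sym (colourᴺ-v _)) (trans eq (colourᴺ-P i j))) cr

  noCrossᴺ : ∀ {a b x y} → Edge G a b → Edge G x y → colourᴺ a b ≡ colourᴺ x y →
    ¬ Cross embeddingᴺ a b x y
  noCrossᴺ {a} {b} {x} {y} ab xy eq with insertView v a | insertView v b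
  ... | inserted | inserted = ⊥-elim (Edge-irrefl G ab)
  ... | inserted | kept _   = new-¬cross ab xy eq
  ... | kept _   | inserted =
        new-¬cross (Edge-sym G ab) xy (trans (colourᴺ-sym (Edge-sym G ab)) eq) ∘ cross-flipˡ embeddingᴺ
  ... | kept i   | kept j with insertView v x | insertView v y
  ...   | inserted | inserted = ⊥-elim (Edge-irrefl G xy)
  ...   | inserted | kept _   = new-¬cross xy ab (sym eq) ∘ cross-sym embeddingᴺ
  ...   | kept _   | inserted =
          new-¬cross (Edge-sym G xy) ab (trans (colourᴺ-sym (Edge-sym G xy)) (sym eq))
          ∘ cross-flipˡ embeddingᴺ ∘ cross-sym embeddingᴺ
  ...   | kept k   | kept l   =
          noCross ab xy (trans (sym (colourᴺ-P i j)) (trans eq (colourᴺ-P k l))) ∘ P-reflects-cross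

  layoutᴺ : Layout m G
  layoutᴺ = record
    { label         = labelᴺ
    ; age           = ageᴺ
    ; pos           = posᴺ
    ; age-injective = ageᴺ-injective
    ; pos-injective = posᴺ-injective
    ; label-proper  = labelᴺ-proper
    ; older-clique  = older-cliqueᴺ
    ; noCross       = noCrossᴺ
    }

  v-colourful : Colourful G colourᴺ v
  v-colourful = youngest-colourful layoutᴺ young
    where
    young : ∀ {x} → Edge G v x → ageᴺ v < ageᴺ x
    young {x} vx with insertView v x
    ... | inserted = ⊥-elim (Edge-irrefl G vx)
    ... | kept i   = v-youngest i

  P-colourful : ∀ {i} → ¬ Edge G v (P i) → Colourful G′ colour i → Colourful G colourᴺ (P i)
  P-colourful {i} ¬vi colourful x y ix iy x≢y with insertView v x | insertView v y
  ... | inserted | _        = ⊥-elim (¬vi (Edge-sym G ix))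
  ... | kept _   | inserted = ⊥-elim (¬vi (Edge-sym G iy))
  ... | kept j   | kept l   = λ eq →
        colourful j l ix iy (x≢y ∘ cong P) (trans (sym (colourᴺ-P i j)) (trans eq (colourᴺ-P i l)))

-- The induction along the k-tree

-- w is the vertex that has to be colourful if G is the base clique: the
-- induction step chooses it as the one vertex of the clique that stays simplicial.
GoodLayout : (k : ℕ) (G : Graph n) → Fin n → Set
GoodLayout k G w = Σ (Layout (suc k) G) λ L →
  (G ≅ K (suc k) → Colourful G (Layout.colour L) w) ×
  (¬ G ≅ K (suc k) → ∀ u → Simplicial k G u → Colourful G (Layout.colour L) u)

goodLayout : ∀ {k} {G : Graph n} → KTree k G → (w : Fin n) → GoodLayout k G w
goodLayout (base G iso) w = layout , (λ _ → w-colourful) , (λ ¬iso → ⊥-elim (¬iso iso))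
  where open CompleteLayout iso w
goodLayout {k = k} (step G v v-simplicial@(v-degree , v-clique) d) _ =
  layoutᴺ , (⊥-elim ∘ KTree-step-≇ {G = G} d) , λ _ → simplicial-colourful
  where
  P = punchIn v
  A = adj G v ∘ P

  nonNeighbour = someWitness (λ i → ¬? (T? (A i))) (KTree-vertex d)
  w′ = proj₁ nonNeighbour

  IH = goodLayout d w′
  L  = proj₁ IH
  open Layout L using (age; label; colour)

  youngest : Σ (Fin _) λ c → ∀ {x} → T (A x) → T (A c) × age c ≤ age x
  youngest with argmin? (λ i → T? (A i)) age
  ... | inj₁ (c , vc , min) = c , λ vx → vc , min vx
  ... | inj₂ none           = w′ , λ vx → ⊥-elim (none _ vx)

  missing = missingLabel A label (s≤s (≤-reflexive (trans (sym (degree-deleted G)) v-degree)))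

  open Extension {G = G} {v} v-clique L (proj₂ youngest) (proj₂ missing)

  old-colourful : ∀ {i} → ¬ T (A i) → Simplicial k (delete G v) i →
    Colourful (delete G v) colour i
  old-colourful {i} ¬vi s with KTree-complete? d
  ... | yes iso = subst (Colourful (delete G v) colour)
                        (nonNeighbour-unique G iso v-simplicial (proj₂ nonNeighbour (i , ¬vi)) ¬vi)
                        (proj₁ (proj₂ IH) iso)
  ... | no ¬iso = proj₂ (proj₂ IH) ¬iso i s

  simplicial-colourful : ∀ u → Simplicial k G u → Colourful G colourᴺ u
  simplicial-colourful u s with insertView v u
  ... | inserted = v-colourful
  ... | kept i with T? (adj G (P i) v)
  ...   | yes iv = ⊥-elim (neighbour-¬simplicial G iv (KTree-degree d i) s)
  ...   | no ¬iv = P-colourful ¬vi (old-colourful ¬vi (simplicial-delete G ¬iv s))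
    where ¬vi = ¬iv ∘ Edge-sym G

-- The construction needs no lower bound on k.
lemma2 : (k : ℕ) → k ≥ 1 → (n : ℕ) → (G : Graph n) → KTree k G →
    Σ (BookEmbedding n) λ β → Σ (Colouring n (suc k)) λ col →
      (∀ u v → Edge G u v → col u v ≡ col v u) ×
      (∀ i → StarForest (ColClass G col i)) ×
      (∀ i a b c d → ColClass G col i a b → ColClass G col i c d →
        ¬ Cross β a b c d) ×
      (G ≅ K (suc k) → ∃ λ v → Colourful G col v) ×
      (¬ (G ≅ K (suc k)) → ∀ v → Simplicial k G v → Colourful G col v)
lemma2 k _ n G t with goodLayout t (KTree-vertex t)
... | L , complete-colourful , simplicial-colourful =
  embedding , colour , (λ _ _ → colour-sym L) , starForest L ,
  (λ i a b c d (ab , ab-i) (cd , cd-i) → noCross ab cd (trans ab-i (sym cd-i))) ,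
  (λ iso → KTree-vertex t , complete-colourful iso) , simplicial-colourful
  where open Layout L
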